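{- Let $\alpha\in(0,1)$ be irrational and $n\ge1$, and let $|\cdot|_{\mathrm{side}}\in\{|\cdot|_{\mathrm{left}},|\cdot|_{\mathrm{right}}\}$ be chosen so that $|n\alpha|_{\mathrm{side}}=\|n\alpha\|$. If $b_0(n)\ge2$, then $|(n-1)\alpha|_{\mathrm{side}}<|n\alpha|_{\mathrm{side}}$ or $|(n+1)\alpha|_{\mathrm{side}}<|n\alpha|_{\mathrm{side}}$. If $\alpha>1/2$, the same conclusion holds under the assumption $b_1(n)\ge2$.
   Context: $\{x\}=x-\lfloor x\rfloor$, $\|x\|$ is the distance from $x$ to the nearest integer, $|\xi|_{\mathrm{left}}:=\{\xi\}$, $|\xi|_{\mathrm{right}}:=\{ -\xi\}$. Let $\alpha=[0;a_1,a_2,\dots]$, $q_0=1$, $q_1=a_1$, $q_{k+1}=a_{k+1}q_k+q_{k-1}$. Every positive integer $n$ has a unique Ostrowski representation $n=\sum_{k=0}^N b_kq_k$ with $0\le b_0\le a_1-1$, $0\le b_k\le a_{k+1}$ ($k\ge1$), and $b_{k-1}=0$ whenever $b_k=a_{k+1}$; $b_k(n)$ denotes $b_k$. -}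

module Defs where

open import Data.Nat as ℕ using (ℕ; zero; suc)
open import Data.Integer as ℤ using (ℤ; +_; -_; _-_)
open import Data.Product using (Σ; ∃; ∃-syntax; _×_; _,_)
open import Data.Sum using (_⊎_)
open import Relation.Binary.PropositionalEquality using (_≡_)

-- The irrational number α = [0; a 1, a 2, ...] ∈ (0,1) is given by its
-- continued fraction digits a : ℕ → ℕ (a 0 is unused), with a (suc k) ≥ 1.
PartialQuotients : (ℕ → ℕ) → Set
PartialQuotients a = ∀ k → 1 ℕ.≤ a (suc k)

q : (ℕ → ℕ) → ℕ → ℕ
q a zero = 1
q a (suc zero) = a 1
q a (suc (suc k)) = a (suc (suc k)) ℕ.* q a (suc k) ℕ.+ q a k

p : (ℕ → ℕ) → ℕ → ℕ
p a zero = 0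
p a (suc zero) = 1
p a (suc (suc k)) = a (suc (suc k)) ℕ.* p a (suc k) ℕ.+ p a k

-- "c·α < d" for integers c, d, where α is the limit of the convergents
-- p_k/q_k (α lies strictly between any two consecutive convergents, and
-- these nested intervals shrink to α).  The linear function x ↦ c x is
-- < d at α iff it is < d at both endpoints of some such interval.
Below : (ℕ → ℕ) → ℤ → ℤ → Set
Below a c d = ∃[ k ] ((c ℤ.* + p a k ℤ.< d ℤ.* + q a k)
                    × (c ℤ.* + p a (suc k) ℤ.< d ℤ.* + q a (suc k)))

-- Real numbers of the form c·α + d, represented by the pair (c , d).
Form : Set
Form = ℤ × ℤ

_<[_]_ : Form → (ℕ → ℕ) → Form → Set
(c , d) <[ a ] (c' , d') = Below a (c - c') (d' - d)

_≤[_]_ : Form → (ℕ → ℕ) → Form → Set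
x ≤[ a ] y = x <[ a ] y ⊎ x ≡ y

Floor : (ℕ → ℕ) → ℤ → ℤ → Set
Floor a c m = ((+ 0 , m) ≤[ a ] (c , + 0)) × ((c , + 0) <[ a ] (+ 0 , m ℤ.+ + 1))

FracIs : (ℕ → ℕ) → ℤ → Form → Set
FracIs a c x = Σ ℤ λ m → Floor a c m × x ≡ (c , - m)

data Side : Set where
  left right : Side

-- |ξ|_left = {ξ},  |ξ|_right = {-ξ}
sgn : Side → ℤ
sgn left = + 1
sgn right = - (+ 1)

SideVal : (ℕ → ℕ) → Side → ℤ → Form → Set
SideVal a s k x = FracIs a (sgn s ℤ.* k) x

IsMin : (ℕ → ℕ) → Form → Form → Form → Set
IsMin a u v x = (x ≡ u ⊎ x ≡ v) × (x ≤[ a ] u) × (x ≤[ a ] v)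

NormVal : (ℕ → ℕ) → ℤ → Form → Set
NormVal a k x = Σ Form λ u → Σ Form λ v → FracIs a k u × FracIs a (- k) v × IsMin a u v x

sumTo : ℕ → (ℕ → ℕ) → ℕ
sumTo zero f = f 0
sumTo (suc N) f = sumTo N f ℕ.+ f (suc N)

IsOstrowski : (ℕ → ℕ) → ℕ → (ℕ → ℕ) → Set
IsOstrowski a n b =
  Σ ℕ λ N → (∀ k → N ℕ.< k → b k ≡ 0)
          × (n ≡ sumTo N (λ k → b k ℕ.* q a k))
          × (b 0 ℕ.< a 1)
          × (∀ k → b (suc k) ℕ.≤ a (suc (suc k)))
          × (∀ k → b (suc k) ≡ a (suc (suc k)) → b k ≡ 0)

module Submission where

open import Defs
open import Data.Nat using (ℕ; suc; _≤_)
open import Data.Integer using (ℤ; +_; _-_; _+_)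
open import Data.Product using (_×_; _,_)
open import Data.Sum using (_⊎_)

open import Data.Nat using (zero; _<_; z≤n; s≤s)
import Data.Nat as ℕ
import Data.Nat.Properties as ℕ
open import Data.Integer using (-_; _*_; _^_; 0ℤ; 1ℤ; -1ℤ; +≤+; +<+)
import Data.Integer as ℤ
import Data.Integer.Properties as ℤ
open import Data.Integer.Tactic.RingSolver using (solve; solve-∀)
open import Data.List using (_∷_; [])
open import Data.Product using (∃-syntax; proj₁; proj₂; swap)
open import Data.Sum using (inj₁; inj₂; [_,_]′)
import Data.Sum as Sum
open import Data.Empty using (⊥; ⊥-elim)
open import Function using (id; _∘_)
open import Relation.Nullary using (yes; no)
open import Relation.Binary.PropositionalEquality
  using (_≡_; _≢_; refl; sym; trans; cong; cong₂; subst; subst₂; module ≡-Reasoning)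

-- Write θₖ = qₖα − pₖ, whose sign is (−1)ᵏ.  As n = Σ bₖqₖ, the number nα is
-- congruent modulo 1 to Σ bₖθₖ, and the digit bounds bₖ₊₁ ≤ aₖ₊₂ confine each
-- normalised tail (−1)^{i+1} Σ_{k>i} bₖθₖ to the open interval (−|θᵢ₊₁|, |θᵢ|).
-- Using the tail after i = 0 when b₀ ≥ 2, and after i = 1 when α > 1/2 (which
-- forces a₁ = 1, b₀ = 0) and b₁ ≥ 2, this puts {nα} strictly between α and
-- 1 − α.  On the other hand, if neither neighbour n ∓ 1 beats n, comparing the
-- floors of (n ∓ 1)α with that of nα gives 0 < |nα|_side < min(α, 1 − α), for
-- either side, which is incompatible with the former.
-- Every inequality involving α is verified at the convergents pⱼ/qⱼ for all
-- large j, which is how such inequalities are encoded (Below).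

Eventually : (ℕ → Set) → Set
Eventually A = ∃[ k ] (∀ j → k ≤ j → A j)

eventually-≥ : ∀ m → Eventually (m ≤_)
eventually-≥ m = m , λ _ m≤j → m≤j

eventually-map : ∀ {A B : ℕ → Set} → (∀ {j} → A j → B j) → Eventually A → Eventually B
eventually-map f (k , h) = k , λ j k≤j → f (h j k≤j)

eventually-× : ∀ {A B : ℕ → Set} → Eventually A → Eventually B → Eventually (λ j → A j × B j)
eventually-× (k , f) (l , g) =
  k ℕ.⊔ l , λ j k⊔l≤j → f j (ℕ.m⊔n≤o⇒m≤o k l k⊔l≤j) ,
                         g j (ℕ.m⊔n≤o⇒n≤o k l k⊔l≤j)

eventually-witness : ∀ {A : ℕ → Set} → Eventually A → ∃[ j ] A j
eventually-witness (k , f) = k , f k ℕ.≤-refl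

either-or-both : ∀ {A B C D : Set} → A ⊎ C → B ⊎ D → (A ⊎ B) ⊎ (C × D)
either-or-both (inj₁ x) _        = inj₁ (inj₁ x)
either-or-both (inj₂ _) (inj₁ y) = inj₁ (inj₂ y)
either-or-both (inj₂ x) (inj₂ y) = inj₂ (x , y)

0≤* : ∀ {i j} → 0ℤ ℤ.≤ i → 0ℤ ℤ.≤ j → 0ℤ ℤ.≤ i * j
0≤* {+ m} {+ n} (+≤+ _) (+≤+ _) = subst (0ℤ ℤ.≤_) (ℤ.pos-* m n) (+≤+ z≤n)

i<j⇒0<j-i : ∀ {i j} → i ℤ.< j → 0ℤ ℤ.< j - i
i<j⇒0<j-i {i} {j} i<j = subst (ℤ._< j - i) (ℤ.+-inverseʳ i) (ℤ.+-monoˡ-< (- i) i<j)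

0<j-i⇒i<j : ∀ {i j} → 0ℤ ℤ.< j - i → i ℤ.< j
0<j-i⇒i<j {i} {j} 0<j-i = begin-strict
  i          ≡⟨ ℤ.+-identityˡ i ⟨
  0ℤ + i     <⟨ ℤ.+-monoˡ-< i 0<j-i ⟩
  j - i + i  ≡⟨ solve (i ∷ j ∷ []) ⟩
  j          ∎
  where open ℤ.≤-Reasoning

<-via : ∀ {i j} u v → j - i ≡ u + v → 0ℤ ℤ.< u → 0ℤ ℤ.≤ v → i ℤ.< j
<-via u v j-i≡u+v 0<u 0≤v =
  0<j-i⇒i<j (subst (0ℤ ℤ.<_) (sym j-i≡u+v) (ℤ.+-mono-<-≤ 0<u 0≤v))

0<A*x+y : ∀ {A x y} → 1ℤ ℤ.≤ A → 0ℤ ℤ.< x → 0ℤ ℤ.≤ y → 0ℤ ℤ.< A * x + y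
0<A*x+y {A} {x} {y} 1≤A 0<x 0≤y =
  <-via x ((A - 1ℤ) * x + y) (solve (A ∷ x ∷ y ∷ [])) 0<x
        (ℤ.+-mono-≤ (0≤* (ℤ.i≤j⇒0≤j-i 1≤A) (ℤ.<⇒≤ 0<x)) 0≤y)

A*x<y⇒x<y : ∀ {A x y} → 1ℤ ℤ.≤ A → 0ℤ ℤ.≤ x → A * x ℤ.< y → x ℤ.< y
A*x<y⇒x<y {A} {x} {y} 1≤A 0≤x Ax<y =
  <-via (y - A * x) ((A - 1ℤ) * x) (solve (A ∷ x ∷ y ∷ [])) (i<j⇒0<j-i Ax<y)
        (0≤* (ℤ.i≤j⇒0≤j-i 1≤A) 0≤x)

A*x<y<2x⇒A<2 : ∀ {A x y} → 0ℤ ℤ.≤ x → A * x ℤ.< y → 0ℤ * x + 1ℤ * y ℤ.< + 2 * x + 0ℤ * y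
  → A ℤ.< + 2
A*x<y<2x⇒A<2 {A} {x} {y} 0≤x Ax<y y<2x =
  ℤ.*-cancelʳ-<-nonNeg x {{ℤ.nonNegative 0≤x}}
    (<-via (+ 2 * x + 0ℤ * y - (0ℤ * x + 1ℤ * y)) (y - A * x) (solve (A ∷ x ∷ y ∷ []))
           (i<j⇒0<j-i y<2x) (ℤ.<⇒≤ (i<j⇒0<j-i Ax<y)))

no-multiple-strictly-between : ∀ k {Q} → .{{ℤ.NonNegative Q}} → 0ℤ ℤ.< k * Q → k * Q ℤ.< Q → ⊥
no-multiple-strictly-between k {Q} 0<kQ kQ<Q =
  ℤ.<-irrefl refl (ℤ.<-≤-trans k<1 (ℤ.i<j⇒suc[i]≤j 0<k))
  where
  0<k : 0ℤ ℤ.< k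
  0<k = ℤ.*-cancelʳ-<-nonNeg {0ℤ} {k} Q 0<kQ
  k<1 : k ℤ.< 1ℤ
  k<1 = ℤ.*-cancelʳ-<-nonNeg {k} {1ℤ} Q (subst (k * Q ℤ.<_) (sym (ℤ.*-identityˡ Q)) kQ<Q)

ostrowski-step : ∀ {β A x y t} → 0ℤ ℤ.≤ β → β ℤ.≤ A → 0ℤ ℤ.≤ x → - y ℤ.< t → t ℤ.< x
  → - x ℤ.< β * x - t × β * x - t ℤ.< A * x + y
ostrowski-step {β} {A} {x} {y} {t} 0≤β β≤A 0≤x -y<t t<x =
  <-via (x - t) (β * x) (solve (β ∷ x ∷ t ∷ [])) (i<j⇒0<j-i t<x) (0≤* 0≤β 0≤x) ,
  <-via (t - - y) ((A - β) * x) (solve (β ∷ A ∷ x ∷ y ∷ t ∷ [])) (i<j⇒0<j-i -y<t)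
        (0≤* (ℤ.i≤j⇒0≤j-i β≤A) 0≤x)

window-b₀ : ∀ {β a₁ P Q d t} → + 2 ℤ.≤ β → β ℤ.< a₁ → 0ℤ ℤ.≤ P → t ≡ -1ℤ * (d - β * P)
  → - (Q - a₁ * P) ℤ.< t → t ℤ.< P → P ℤ.< d × d ℤ.< Q - P
window-b₀ {β} {a₁} {P} {Q} {d} 2≤β β<a₁ 0≤P refl -e₁<t t<P =
  <-via (P - -1ℤ * (d - β * P)) ((β - + 2) * P) (solve (β ∷ P ∷ d ∷ [])) (i<j⇒0<j-i t<P)
        (0≤* (ℤ.i≤j⇒0≤j-i 2≤β) 0≤P) ,
  <-via (-1ℤ * (d - β * P) - - (Q - a₁ * P)) ((a₁ - (1ℤ + β)) * P)
        (solve (β ∷ a₁ ∷ P ∷ Q ∷ d ∷ [])) (i<j⇒0<j-i -e₁<t)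
        (0≤* (ℤ.i≤j⇒0≤j-i (ℤ.i<j⇒suc[i]≤j β<a₁)) 0≤P)

window-b₁ : ∀ {β a₂ P Q d t} → + 2 ℤ.≤ β → β ℤ.≤ a₂ → P ℤ.≤ Q → t ≡ 1ℤ * (d - β * (P - Q))
  → - (P - a₂ * (Q - P)) ℤ.< t → t ℤ.< Q - P → Q - P ℤ.< d + Q × d + Q ℤ.< P
window-b₁ {β} {a₂} {P} {Q} {d} 2≤β β≤a₂ P≤Q refl -e₂<t t<e₁ =
  <-via (1ℤ * (d - β * (P - Q)) - - (P - a₂ * (Q - P))) ((a₂ - β) * (Q - P))
        (solve (β ∷ a₂ ∷ P ∷ Q ∷ d ∷ [])) (i<j⇒0<j-i -e₂<t)
        (0≤* (ℤ.i≤j⇒0≤j-i β≤a₂) (ℤ.i≤j⇒0≤j-i P≤Q)) ,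
  <-via (Q - P - 1ℤ * (d - β * (P - Q))) ((β - + 2) * (Q - P))
        (solve (β ∷ P ∷ Q ∷ d ∷ [])) (i<j⇒0<j-i t<e₁)
        (0≤* (ℤ.i≤j⇒0≤j-i 2≤β) (ℤ.i≤j⇒0≤j-i P≤Q))

Between : ℤ → ℤ → ℤ → Set
Between u v x = (u ℤ.< x × x ℤ.< v) ⊎ (v ℤ.< x × x ℤ.< u)

residue-congruence : ∀ s {n P Q M m K}
  → (n * P - M * Q + K * Q) - sgn s * (sgn s * n * P + - m * Q) ≡ (K - M + sgn s * m) * Q
residue-congruence left  {n} {P} {Q} {M} {m} {K} = solve (n ∷ P ∷ Q ∷ M ∷ m ∷ K ∷ [])
residue-congruence right {n} {P} {Q} {M} {m} {K} = solve (n ∷ P ∷ Q ∷ M ∷ m ∷ K ∷ [])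

no-residue-in-window : ∀ s {P Q r x} k → .{{ℤ.NonNegative Q}}
  → 0ℤ ℤ.< r → r ℤ.< P → r ℤ.< Q - P → Between P (Q - P) x → x - sgn s * r ≡ k * Q → ⊥
no-residue-in-window s {P} {Q} {r} {x} k 0<r r<P r<Q-P x-between x-σr≡kQ =
  no-multiple-strictly-between k (subst (0ℤ ℤ.<_) x-σr≡kQ (0<x-σr s))
                                 (subst (ℤ._< Q) x-σr≡kQ (x-σr<Q s))
  where
  0≤r+r : 0ℤ ℤ.≤ r + r
  0≤r+r = ℤ.<⇒≤ (ℤ.+-mono-< 0<r 0<r)

  r<x×x<Q-r : Between P (Q - P) x → r ℤ.< x × x ℤ.< Q - r
  r<x×x<Q-r (inj₁ (P<x , x<Q-P)) =
    ℤ.<-trans r<P P<x ,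
    ℤ.<-trans x<Q-P (ℤ.+-monoʳ-< Q (ℤ.neg-mono-< r<P))
  r<x×x<Q-r (inj₂ (Q-P<x , x<P)) =
    ℤ.<-trans r<Q-P Q-P<x ,
    ℤ.<-trans x<P (<-via (Q - P - r) 0ℤ (solve (P ∷ Q ∷ r ∷ [])) (i<j⇒0<j-i r<Q-P) ℤ.≤-refl)

  r<x : r ℤ.< x
  r<x = proj₁ (r<x×x<Q-r x-between)

  x<Q-r : x ℤ.< Q - r
  x<Q-r = proj₂ (r<x×x<Q-r x-between)

  0<x-σr : ∀ s → 0ℤ ℤ.< x - sgn s * r
  0<x-σr left  = <-via (x - r) 0ℤ (solve (r ∷ x ∷ [])) (i<j⇒0<j-i r<x) ℤ.≤-refl
  0<x-σr right = <-via (x - r) (r + r) (solve (r ∷ x ∷ [])) (i<j⇒0<j-i r<x) 0≤r+r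

  x-σr<Q : ∀ s → x - sgn s * r ℤ.< Q
  x-σr<Q left  = <-via (Q - r - x) (r + r) (solve (Q ∷ r ∷ x ∷ [])) (i<j⇒0<j-i x<Q-r) 0≤r+r
  x-σr<Q right = <-via (Q - r - x) 0ℤ (solve (Q ∷ r ∷ x ∷ [])) (i<j⇒0<j-i x<Q-r) ℤ.≤-refl

fraction-bounds : ∀ {c m P Q}
  → 0ℤ * P + m * Q ℤ.< c * P + 0ℤ * Q
  → c * P + - m * Q ℤ.< 1ℤ * P + 0ℤ * Q
  → c * P + - m * Q ℤ.< -1ℤ * P + 1ℤ * Q
  → 0ℤ ℤ.< c * P + - m * Q × c * P + - m * Q ℤ.< P × c * P + - m * Q ℤ.< Q - P
fraction-bounds {c} {m} {P} {Q} 0<y y<α y<1-α =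
  <-via (c * P + 0ℤ * Q - (0ℤ * P + m * Q)) 0ℤ (solve (c ∷ m ∷ P ∷ Q ∷ []))
        (i<j⇒0<j-i 0<y) ℤ.≤-refl ,
  <-via (1ℤ * P + 0ℤ * Q - (c * P + - m * Q)) 0ℤ (solve (c ∷ m ∷ P ∷ Q ∷ []))
        (i<j⇒0<j-i y<α) ℤ.≤-refl ,
  <-via (-1ℤ * P + 1ℤ * Q - (c * P + - m * Q)) 0ℤ (solve (c ∷ m ∷ P ∷ Q ∷ []))
        (i<j⇒0<j-i y<1-α) ℤ.≤-refl

sgn*pos≢0 : ∀ s {n} → 1 ≤ n → + 0 ≢ sgn s * + n
sgn*pos≢0 left  (s≤s _) ()
sgn*pos≢0 right (s≤s _) ()

-1ℤ^k*-1ℤ^k≡1 : ∀ k → -1ℤ ^ k * -1ℤ ^ k ≡ 1ℤ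
-1ℤ^k*-1ℤ^k≡1 zero    = refl
-1ℤ^k*-1ℤ^k≡1 (suc k) = trans (square-neg (-1ℤ ^ k)) (-1ℤ^k*-1ℤ^k≡1 k)
  where
  square-neg : ∀ s → -1ℤ * s * (-1ℤ * s) ≡ s * s
  square-neg = solve-∀

α 1-α : Form
α   = 1ℤ , 0ℤ
1-α = -1ℤ , 1ℤ

module Convergents (a : ℕ → ℕ) where

  P Q : ℕ → ℤ
  P k = + p a k
  Q k = + q a k

  Continuant : (ℕ → ℤ) → Set
  Continuant u = ∀ k → u (suc (suc k)) ≡ + a (suc (suc k)) * u (suc k) + u k

  P-continuant : Continuant P
  P-continuant k = trans (ℤ.pos-+ (a (suc (suc k)) ℕ.* p a (suc k)) (p a k))
                         (cong (_+ P k) (ℤ.pos-* (a (suc (suc k))) (p a (suc k))))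

  Q-continuant : Continuant Q
  Q-continuant k = trans (ℤ.pos-+ (a (suc (suc k)) ℕ.* q a (suc k)) (q a k))
                         (cong (_+ Q k) (ℤ.pos-* (a (suc (suc k))) (q a (suc k))))

  continuant-positive : ∀ {u} → Continuant u → ∀ {k} → 0ℤ ℤ.< u k → 0ℤ ℤ.< u (suc k)
    → Eventually (λ j → 0ℤ ℤ.< u j)
  continuant-positive {u} u-rec {k} 0<uₖ 0<uₖ₊₁ =
    k , λ j k≤j → subst (λ i → 0ℤ ℤ.< u i) (ℕ.m∸n+n≡m k≤j)
                        (proj₁ (positive-pair (j ℕ.∸ k)))
    where
    positive-pair : ∀ t → 0ℤ ℤ.< u (t ℕ.+ k) × 0ℤ ℤ.< u (suc (t ℕ.+ k))
    positive-pair zero = 0<uₖ , 0<uₖ₊₁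
    positive-pair (suc t) with positive-pair t
    ... | 0<u , 0<u′ =
      0<u′ ,
      subst (0ℤ ℤ.<_) (sym (u-rec (t ℕ.+ k)))
            (ℤ.+-mono-≤-< (0≤* {+ a (suc (suc (t ℕ.+ k)))} (+≤+ z≤n) (ℤ.<⇒≤ 0<u′)) 0<u)

  gap : ℤ → ℤ → ℕ → ℤ
  gap c d k = d * Q k - c * P k

  gap-continuant : ∀ c d → Continuant (gap c d)
  gap-continuant c d k =
    trans (cong₂ (λ x y → d * x - c * y) (Q-continuant k) (P-continuant k))
          (regroup (+ a (suc (suc k))) (Q (suc k)) (Q k) (P (suc k)) (P k))
    where
    regroup : ∀ A x₁ x₀ y₁ y₀
      → d * (A * x₁ + x₀) - c * (A * y₁ + y₀) ≡ A * (d * x₁ - c * y₁) + (d * x₀ - c * y₀)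
    regroup A x₁ x₀ y₁ y₀ = solve (c ∷ d ∷ A ∷ x₁ ∷ x₀ ∷ y₁ ∷ y₀ ∷ [])

  below⇒eventually : ∀ {c d} → Below a c d → Eventually (λ j → 0ℤ ℤ.< gap c d j)
  below⇒eventually {c} {d} (k , below₀ , below₁) =
    continuant-positive {gap c d} (gap-continuant c d) {k} (i<j⇒0<j-i below₀) (i<j⇒0<j-i below₁)

  eventually⇒below : ∀ {c d} → Eventually (λ j → 0ℤ ℤ.< gap c d j) → Below a c d
  eventually⇒below (k , f) = k , 0<j-i⇒i<j (f k ℕ.≤-refl) , 0<j-i⇒i<j (f (suc k) (ℕ.n≤1+n k))

  ⟦_⟧ : Form → ℕ → ℤ
  ⟦ c , d ⟧ j = c * P j + d * Q j

  form-gap : ∀ c d c' d' x y → (d' - d) * y - (c - c') * x ≡ (c' * x + d' * y) - (c * x + d * y)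
  form-gap = solve-∀

  <[]⇒eventually : ∀ {x y} → x <[ a ] y → Eventually (λ j → ⟦ x ⟧ j ℤ.< ⟦ y ⟧ j)
  <[]⇒eventually {c , d} {c' , d'} x<y =
    eventually-map (λ {j} → 0<j-i⇒i<j ∘ subst (0ℤ ℤ.<_) (form-gap c d c' d' (P j) (Q j)))
                   (below⇒eventually {c - c'} {d' - d} x<y)

  eventually⇒<[] : ∀ {x y} → Eventually (λ j → ⟦ x ⟧ j ℤ.< ⟦ y ⟧ j) → x <[ a ] y
  eventually⇒<[] {c , d} {c' , d'} x<y =
    eventually⇒below {c - c'} {d' - d}
      (eventually-map (λ {j} → subst (0ℤ ℤ.<_) (sym (form-gap c d c' d' (P j) (Q j))) ∘ i<j⇒0<j-i) x<y)

  -- θ j k is qⱼ (qₖα − pₖ) with α replaced by pⱼ/qⱼ.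
  θ : ℕ → ℕ → ℤ
  θ j = gap (Q j) (P j)

  ∣θ∣ : ℕ → ℕ → ℤ
  ∣θ∣ j k = -1ℤ ^ k * θ j k

  θ-adjacent : ∀ k → θ (suc k) k ≡ -1ℤ ^ k
  θ-adjacent zero = base (+ a 1)
    where
    base : ∀ A → 1ℤ * 1ℤ - A * 0ℤ ≡ 1ℤ
    base = solve-∀
  θ-adjacent (suc k) =
    trans (cong₂ (λ x y → x * Q (suc k) - y * P (suc k)) (P-continuant k) (Q-continuant k))
    (trans (swap-sign (+ a (suc (suc k))) (P (suc k)) (P k) (Q (suc k)) (Q k))
           (cong (-1ℤ *_) (θ-adjacent k)))
    where
    swap-sign : ∀ A x₁ x₀ y₁ y₀
      → (A * x₁ + x₀) * y₁ - (A * y₁ + y₀) * x₁ ≡ -1ℤ * (x₁ * y₀ - y₁ * x₀)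
    swap-sign = solve-∀

  ∣θ∣-adjacent : ∀ k → ∣θ∣ (suc k) k ≡ 1ℤ
  ∣θ∣-adjacent k = trans (cong (-1ℤ ^ k *_) (θ-adjacent k)) (-1ℤ^k*-1ℤ^k≡1 k)

  ∣θ∣-diagonal : ∀ j → ∣θ∣ j j ≡ 0ℤ
  ∣θ∣-diagonal j = vanish (-1ℤ ^ j) (P j) (Q j)
    where
    vanish : ∀ s x y → s * (x * y - y * x) ≡ 0ℤ
    vanish = solve-∀

  ∣θ∣-continuant : ∀ j k
    → ∣θ∣ j k ≡ + a (suc (suc k)) * ∣θ∣ j (suc k) + ∣θ∣ j (suc (suc k))
  ∣θ∣-continuant j k =
    trans (regroup (-1ℤ ^ k) (+ a (suc (suc k))) (θ j (suc k)) (θ j k))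
          (cong (λ z → + a (suc (suc k)) * ∣θ∣ j (suc k) + -1ℤ * (-1ℤ * -1ℤ ^ k) * z)
                (sym (gap-continuant (Q j) (P j) k)))
    where
    regroup : ∀ s A x₁ x₀ → s * x₀ ≡ A * (-1ℤ * s * x₁) + -1ℤ * (-1ℤ * s) * (A * x₁ + x₀)
    regroup = solve-∀

  ∣θ∣-zero : ∀ j → ∣θ∣ j 0 ≡ P j
  ∣θ∣-zero j = eval (P j) (Q j)
    where
    eval : ∀ x y → 1ℤ * (x * 1ℤ - y * 0ℤ) ≡ x
    eval = solve-∀

  ∣θ∣-one : ∀ j → ∣θ∣ j 1 ≡ Q j - + a 1 * P j
  ∣θ∣-one j = eval (+ a 1) (P j) (Q j)
    where
    eval : ∀ A x y → -1ℤ * (x * A - y * 1ℤ) ≡ y - A * x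
    eval = solve-∀

  module _ (a-pos : PartialQuotients a) where

    ∣θ∣-positive : ∀ {j k} → k < j → 0ℤ ℤ.< ∣θ∣ j k
    ∣θ∣-positive {j} {k} k<j = proj₁ (descend (j ℕ.∸ suc k) k (ℕ.m∸n+n≡m k<j))
      where
      descend : ∀ {j} d k → d ℕ.+ suc k ≡ j → 0ℤ ℤ.< ∣θ∣ j k × 0ℤ ℤ.≤ ∣θ∣ j (suc k)
      descend zero k refl =
        subst (0ℤ ℤ.<_) (sym (∣θ∣-adjacent k)) (+<+ (s≤s z≤n)) ,
        subst (0ℤ ℤ.≤_) (sym (∣θ∣-diagonal (suc k))) ℤ.≤-refl
      descend {j} (suc d) k d+k+2≡j with descend d (suc k) (trans (ℕ.+-suc d (suc k)) d+k+2≡j)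
      ... | 0<θₖ₊₁ , 0≤θₖ₊₂ =
        subst (0ℤ ℤ.<_) (sym (∣θ∣-continuant j k))
              (0<A*x+y (+≤+ (a-pos (suc k))) 0<θₖ₊₁ 0≤θₖ₊₂) ,
        ℤ.<⇒≤ 0<θₖ₊₁

    ∣θ∣-nonneg : ∀ {j k} → k ≤ j → 0ℤ ℤ.≤ ∣θ∣ j k
    ∣θ∣-nonneg {j} {k} k≤j with ℕ.m≤n⇒m<n∨m≡n k≤j
    ... | inj₁ k<j  = ℤ.<⇒≤ (∣θ∣-positive k<j)
    ... | inj₂ refl = subst (0ℤ ℤ.≤_) (sym (∣θ∣-diagonal k)) ℤ.≤-refl

    a₁P<Q : ∀ {j} → 2 ≤ j → + a 1 * P j ℤ.< Q j
    a₁P<Q {j} 2≤j = 0<j-i⇒i<j (subst (0ℤ ℤ.<_) (∣θ∣-one j) (∣θ∣-positive 2≤j))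

    P-positive : ∀ {j} → 1 ≤ j → 0ℤ ℤ.< P j
    P-positive {j} 1≤j = subst (0ℤ ℤ.<_) (∣θ∣-zero j) (∣θ∣-positive 1≤j)

    P<Q : ∀ {j} → 2 ≤ j → P j ℤ.< Q j
    P<Q {j} 2≤j = A*x<y⇒x<y (+≤+ (a-pos 0)) (+≤+ z≤n) (a₁P<Q 2≤j)

    ½<α⇒a₁≡1 : ∀ {j} → 2 ≤ j → ⟦ 0ℤ , 1ℤ ⟧ j ℤ.< ⟦ + 2 , 0ℤ ⟧ j → a 1 ≡ 1
    ½<α⇒a₁≡1 {j} 2≤j ½<α = ℕ.≤-antisym (ℕ.s≤s⁻¹ (ℤ.drop‿+<+ a₁<2)) (a-pos 0)
      where
      a₁<2 : + a 1 ℤ.< + 2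
      a₁<2 = A*x<y<2x⇒A<2 {x = P j} {Q j} (+≤+ z≤n) (a₁P<Q 2≤j) ½<α

    a₁≡1⇒∣θ∣-one : a 1 ≡ 1 → ∀ j → ∣θ∣ j 1 ≡ Q j - P j
    a₁≡1⇒∣θ∣-one a₁≡1 j =
      trans (∣θ∣-one j)
            (cong (λ z → Q j - z) (trans (cong (λ A → + A * P j) a₁≡1) (ℤ.*-identityˡ (P j))))

    a₁≡1⇒∣θ∣-two : a 1 ≡ 1 → ∀ j → ∣θ∣ j 2 ≡ P j - + a 2 * (Q j - P j)
    a₁≡1⇒∣θ∣-two a₁≡1 j =
      trans (isolate (+ a 2) (∣θ∣ j 1) (∣θ∣ j 2))
            (cong₂ (λ z w → z - + a 2 * w) (trans (sym (∣θ∣-continuant j 0)) (∣θ∣-zero j))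
                   (a₁≡1⇒∣θ∣-one a₁≡1 j))
      where
      isolate : ∀ A y w → w ≡ (A * y + w) - A * y
      isolate = solve-∀

    lower-neighbour : ∀ {c c' m m'} → c' ≡ c - 1ℤ → (c' , 0ℤ) <[ a ] (0ℤ , m' + 1ℤ)
      → ((c' , - m') <[ a ] (c , - m)) ⊎ ((c , - m) <[ a ] α)
    lower-neighbour {c} {m = m} {m'} refl floor-bound with m ℤ.≤? m'
    ... | yes m≤m' =
      inj₁ (eventually⇒<[] {c - 1ℤ , - m'} {c , - m}
              (eventually-map (λ {j} 1≤j → neighbour-smaller {P j} {Q j} (P-positive 1≤j) (+≤+ z≤n))
                              (eventually-≥ 1)))
      where
      neighbour-smaller : ∀ {P Q} → 0ℤ ℤ.< P → 0ℤ ℤ.≤ Q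
        → (c - 1ℤ) * P + - m' * Q ℤ.< c * P + - m * Q
      neighbour-smaller {P} {Q} 0<P 0≤Q =
        <-via P ((m' - m) * Q) (solve (c ∷ m ∷ m' ∷ P ∷ Q ∷ [])) 0<P
              (0≤* (ℤ.i≤j⇒0≤j-i m≤m') 0≤Q)
    ... | no m≰m' =
      inj₂ (eventually⇒<[] {c , - m} {α}
              (eventually-map (λ {j} → fraction-small {P j} {Q j} (+≤+ z≤n))
                              (<[]⇒eventually {c - 1ℤ , 0ℤ} {0ℤ , m' + 1ℤ} floor-bound)))
      where
      1+m'≤m : 1ℤ + m' ℤ.≤ m
      1+m'≤m = ℤ.i<j⇒suc[i]≤j (ℤ.≰⇒> m≰m')
      fraction-small : ∀ {P Q} → 0ℤ ℤ.≤ Q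
        → (c - 1ℤ) * P + 0ℤ * Q ℤ.< 0ℤ * P + (m' + 1ℤ) * Q
        → c * P + - m * Q ℤ.< 1ℤ * P + 0ℤ * Q
      fraction-small {P} {Q} 0≤Q below =
        <-via (0ℤ * P + (m' + 1ℤ) * Q - ((c - 1ℤ) * P + 0ℤ * Q)) ((m - (1ℤ + m')) * Q)
              (solve (c ∷ m ∷ m' ∷ P ∷ Q ∷ [])) (i<j⇒0<j-i below)
              (0≤* (ℤ.i≤j⇒0≤j-i 1+m'≤m) 0≤Q)

    upper-neighbour : ∀ {c c' m m'} → c' ≡ c + 1ℤ → (c' , 0ℤ) <[ a ] (0ℤ , m' + 1ℤ)
      → ((c' , - m') <[ a ] (c , - m)) ⊎ ((c , - m) <[ a ] 1-α)
    upper-neighbour {c} {m = m} {m'} refl floor-bound with m' ℤ.≤? m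
    ... | yes m'≤m =
      inj₂ (eventually⇒<[] {c , - m} {1-α}
              (eventually-map (λ {j} → fraction-small {P j} {Q j} (+≤+ z≤n))
                              (<[]⇒eventually {c + 1ℤ , 0ℤ} {0ℤ , m' + 1ℤ} floor-bound)))
      where
      fraction-small : ∀ {P Q} → 0ℤ ℤ.≤ Q
        → (c + 1ℤ) * P + 0ℤ * Q ℤ.< 0ℤ * P + (m' + 1ℤ) * Q
        → c * P + - m * Q ℤ.< -1ℤ * P + 1ℤ * Q
      fraction-small {P} {Q} 0≤Q below =
        <-via (0ℤ * P + (m' + 1ℤ) * Q - ((c + 1ℤ) * P + 0ℤ * Q)) ((m - m') * Q)
              (solve (c ∷ m ∷ m' ∷ P ∷ Q ∷ [])) (i<j⇒0<j-i below)
              (0≤* (ℤ.i≤j⇒0≤j-i m'≤m) 0≤Q)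
    ... | no m'≰m =
      inj₁ (eventually⇒<[] {c + 1ℤ , - m'} {c , - m}
              (eventually-map (λ {j} 2≤j → neighbour-smaller {P j} {Q j} (+≤+ z≤n) (P<Q 2≤j))
                              (eventually-≥ 2)))
      where
      1+m≤m' : 1ℤ + m ℤ.≤ m'
      1+m≤m' = ℤ.i<j⇒suc[i]≤j (ℤ.≰⇒> m'≰m)
      neighbour-smaller : ∀ {P Q} → 0ℤ ℤ.≤ Q → P ℤ.< Q
        → (c + 1ℤ) * P + - m' * Q ℤ.< c * P + - m * Q
      neighbour-smaller {P} {Q} 0≤Q P<Q =
        <-via (Q - P) ((m' - (1ℤ + m)) * Q) (solve (c ∷ m ∷ m' ∷ P ∷ Q ∷ [])) (i<j⇒0<j-i P<Q)
              (0≤* (ℤ.i≤j⇒0≤j-i 1+m≤m') 0≤Q)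

    neighbours-or-small : ∀ s {x m m₋ m₊}
      → (sgn s * (x - 1ℤ) , 0ℤ) <[ a ] (0ℤ , m₋ + 1ℤ)
      → (sgn s * (x + 1ℤ) , 0ℤ) <[ a ] (0ℤ , m₊ + 1ℤ)
      → ((sgn s * (x - 1ℤ) , - m₋) <[ a ] (sgn s * x , - m)
          ⊎ (sgn s * (x + 1ℤ) , - m₊) <[ a ] (sgn s * x , - m))
        ⊎ ((sgn s * x , - m) <[ a ] α × (sgn s * x , - m) <[ a ] 1-α)
    neighbours-or-small left {x} {m} {m₋} {m₊} below above =
      either-or-both (lower-neighbour {sgn left * x} {m = m} {m₋} shift₋ below)
                     (upper-neighbour {sgn left * x} {m = m} {m₊} shift₊ above)
      where
      shift₋ : sgn left * (x - 1ℤ) ≡ sgn left * x - 1ℤ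
      shift₋ = solve (x ∷ [])
      shift₊ : sgn left * (x + 1ℤ) ≡ sgn left * x + 1ℤ
      shift₊ = solve (x ∷ [])
    neighbours-or-small right {x} {m} {m₋} {m₊} below above =
      Sum.map₂ swap (either-or-both (upper-neighbour {sgn right * x} {m = m} {m₋} shift₋ below)
                                    (lower-neighbour {sgn right * x} {m = m} {m₊} shift₊ above))
      where
      shift₋ : sgn right * (x - 1ℤ) ≡ sgn right * x + 1ℤ
      shift₋ = solve (x ∷ [])
      shift₊ : sgn right * (x + 1ℤ) ≡ sgn right * x - 1ℤ
      shift₊ = solve (x ∷ [])

    module Ostrowski (b : ℕ → ℕ) (b₀<a₁ : b 0 < a 1)
                     (bₖ₊₁≤aₖ₊₂ : ∀ k → b (suc k) ≤ a (suc (suc k))) where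

      Σbq Σbp : ℕ → ℕ
      Σbq N = sumTo N (λ k → b k ℕ.* q a k)
      Σbp N = sumTo N (λ k → b k ℕ.* p a k)

      DigitCondition : ℕ → Set
      DigitCondition j = 2 ≤ b 0 ⊎ (⟦ 0ℤ , 1ℤ ⟧ j ℤ.< ⟦ + 2 , 0ℤ ⟧ j × 2 ≤ b 1)

      Σbθ : ℕ → ℕ → ℤ
      Σbθ j N = + Σbq N * P j - + Σbp N * Q j

      Σbθ-zero : ∀ j → Σbθ j 0 ≡ + b 0 * P j
      Σbθ-zero j =
        trans (cong₂ (λ x y → + x * P j - + y * Q j) (ℕ.*-identityʳ (b 0)) (ℕ.*-zeroʳ (b 0)))
              (ℤ.+-identityʳ (+ b 0 * P j))

      Σbθ-suc : ∀ j N → Σbθ j (suc N) ≡ Σbθ j N + + b (suc N) * θ j (suc N)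
      Σbθ-suc j N =
        trans (cong₂ (λ x y → x * P j - y * Q j)
                     (pos-sum (b (suc N)) (q a (suc N))) (pos-sum (b (suc N)) (p a (suc N))))
              (regroup (+ Σbq N) (+ Σbp N) (+ b (suc N))
                       (Q (suc N)) (P (suc N)) (P j) (Q j))
        where
        pos-sum : ∀ {x} y z → + (x ℕ.+ y ℕ.* z) ≡ + x + + y * + z
        pos-sum {x} y z = trans (ℤ.pos-+ x (y ℕ.* z)) (cong (λ w → + x + w) (ℤ.pos-* y z))
        regroup : ∀ n M β q′ p′ x y
          → (n + β * q′) * x - (M + β * p′) * y ≡ n * x - M * y + β * (x * q′ - y * p′)
        regroup = solve-∀

      -- tail j N i = Σ_{i<k≤N} (−1)^{k−i−1} bₖ |θ j k|
      tail : ℕ → ℕ → ℕ → ℤ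
      tail j N i = -1ℤ ^ suc i * (Σbθ j N - Σbθ j i)

      tail-suc : ∀ j N i → tail j N i ≡ + b (suc i) * ∣θ∣ j (suc i) - tail j N (suc i)
      tail-suc j N i =
        trans (peel (-1ℤ ^ suc i) (Σbθ j N) (Σbθ j i) (+ b (suc i)) (θ j (suc i)))
              (cong (λ z → + b (suc i) * ∣θ∣ j (suc i) - -1ℤ * -1ℤ ^ suc i * (Σbθ j N - z))
                    (sym (Σbθ-suc j i)))
        where
        peel : ∀ s D Dᵢ β t → s * (D - Dᵢ) ≡ β * (s * t) - -1ℤ * s * (D - (Dᵢ + β * t))
        peel = solve-∀

      tail-bounds : ∀ {j N i} → i ≤ N → suc N < j
        → - ∣θ∣ j (suc i) ℤ.< tail j N i × tail j N i ℤ.< ∣θ∣ j i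
      tail-bounds {j} {N} {i} i≤N N+1<j = from-top (N ℕ.∸ i) i (ℕ.m∸n+n≡m i≤N) N+1<j
        where
        from-top : ∀ {N} d i → d ℕ.+ i ≡ N → suc N < j
          → - ∣θ∣ j (suc i) ℤ.< tail j N i × tail j N i ℤ.< ∣θ∣ j i
        from-top zero i refl i+1<j =
          subst (- ∣θ∣ j (suc i) ℤ.<_) (sym tail-vanishes) (ℤ.neg-mono-< (∣θ∣-positive i+1<j)) ,
          subst (ℤ._< ∣θ∣ j i) (sym tail-vanishes) (∣θ∣-positive (ℕ.<-trans (ℕ.n<1+n i) i+1<j))
          where
          vanish : ∀ s x → s * (x - x) ≡ 0ℤ
          vanish = solve-∀
          tail-vanishes : tail j i i ≡ 0ℤ
          tail-vanishes = vanish (-1ℤ ^ suc i) (Σbθ j i)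
        from-top {N} (suc d) i d+i+1≡N N+1<j with from-top d (suc i) (trans (ℕ.+-suc d i) d+i+1≡N) N+1<j
        ... | -θᵢ₊₂<tail , tail<θᵢ₊₁ =
          subst₂ (λ t z → - ∣θ∣ j (suc i) ℤ.< t × t ℤ.< z)
                 (sym (tail-suc j N i)) (sym (∣θ∣-continuant j i))
                 (ostrowski-step (+≤+ z≤n) (+≤+ (bₖ₊₁≤aₖ₊₂ i)) (∣θ∣-nonneg i+1≤j)
                                 -θᵢ₊₂<tail tail<θᵢ₊₁)
          where
          i+1≤j : suc i ≤ j
          i+1≤j = ℕ.≤-trans (ℕ.≤-trans (s≤s (ℕ.m≤n+m i d)) (ℕ.≤-reflexive d+i+1≡N))
                            (ℕ.<⇒≤ (ℕ.<-trans (ℕ.n<1+n N) N+1<j))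

      ostrowski-middle : ∀ {N j} → 1 ≤ N → suc N < j
        → DigitCondition j
        → ∃[ K ] Between (P j) (Q j - P j) (Σbθ j N + K * Q j)
      ostrowski-middle {N} {j} _ N+1<j (inj₁ 2≤b₀) with tail-bounds z≤n N+1<j
      ... | -θ₁<tail , tail<θ₀ =
        0ℤ , inj₁ (subst (λ x → P j ℤ.< x × x ℤ.< Q j - P j) (sym (ℤ.+-identityʳ (Σbθ j N)))
                    (window-b₀ {P = P j} {Q = Q j} {d = Σbθ j N}
                       (+≤+ 2≤b₀) (+<+ b₀<a₁) (+≤+ z≤n)
                       (cong (λ z → -1ℤ * (Σbθ j N - z)) (Σbθ-zero j))
                       (subst (λ e → - e ℤ.< tail j N 0) (∣θ∣-one j) -θ₁<tail)
                       (subst (tail j N 0 ℤ.<_) (∣θ∣-zero j) tail<θ₀)))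
      ostrowski-middle {N} {j} 1≤N N+1<j (inj₂ (½<α , 2≤b₁)) with tail-bounds 1≤N N+1<j
      ... | -θ₂<tail , tail<θ₁ =
        1ℤ , inj₂ (subst (λ x → Q j - P j ℤ.< x × x ℤ.< P j)
                         (cong (λ z → Σbθ j N + z) (sym (ℤ.*-identityˡ (Q j))))
                    (window-b₁ {P = P j} {Q = Q j} {d = Σbθ j N}
                       (+≤+ 2≤b₁) (+≤+ (bₖ₊₁≤aₖ₊₂ 0)) (ℤ.<⇒≤ (P<Q 2≤j))
                       (cong (λ z → 1ℤ * (Σbθ j N - z)) Σbθ-one)
                       (subst (λ e → - e ℤ.< tail j N 1) (a₁≡1⇒∣θ∣-two a₁≡1 j) -θ₂<tail)
                       (subst (tail j N 1 ℤ.<_) (a₁≡1⇒∣θ∣-one a₁≡1 j) tail<θ₁)))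
        where
        2≤j : 2 ≤ j
        2≤j = ℕ.<⇒≤ (ℕ.≤-<-trans (s≤s 1≤N) N+1<j)
        a₁≡1 : a 1 ≡ 1
        a₁≡1 = ½<α⇒a₁≡1 2≤j ½<α
        b₀≡0 : b 0 ≡ 0
        b₀≡0 = ℕ.n<1⇒n≡0 (subst (b 0 <_) a₁≡1 b₀<a₁)
        Σbθ-one : Σbθ j 1 ≡ + b 1 * (P j - Q j)
        Σbθ-one = begin
          Σbθ j 1                                          ≡⟨ Σbθ-suc j 0 ⟩
          Σbθ j 0 + + b 1 * θ j 1                          ≡⟨ cong (_+ + b 1 * θ j 1) (Σbθ-zero j) ⟩
          + b 0 * P j + + b 1 * (P j * + a 1 - Q j * 1ℤ)
            ≡⟨ cong₂ (λ u v → + u * P j + + b 1 * (P j * + v - Q j * 1ℤ)) b₀≡0 a₁≡1 ⟩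
          0ℤ * P j + + b 1 * (P j * 1ℤ - Q j * 1ℤ)         ≡⟨ simplify (+ b 1) (P j) (Q j) ⟩
          + b 1 * (P j - Q j)                              ∎
          where
          open ≡-Reasoning
          simplify : ∀ β x y → 0ℤ * x + β * (x * 1ℤ - y * 1ℤ) ≡ β * (x - y)
          simplify = solve-∀

      eventually-digit-condition : (2 ≤ b 0 ⊎ (((+ 0 , + 1) <[ a ] (+ 2 , + 0)) × 2 ≤ b 1))
        → Eventually DigitCondition
      eventually-digit-condition (inj₁ 2≤b₀)         = 0 , λ _ _ → inj₁ 2≤b₀
      eventually-digit-condition (inj₂ (½<α , 2≤b₁)) =
        eventually-map (λ ½<α → inj₂ (½<α , 2≤b₁)) (<[]⇒eventually {+ 0 , + 1} {+ 2 , + 0} ½<α)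

      Σbq-vanishing : ∀ {L} → (∀ k → L < k → b k ≡ 0) → Σbq (suc L) ≡ Σbq L
      Σbq-vanishing {L} vanish =
        trans (cong (λ β → Σbq L ℕ.+ β ℕ.* q a (suc L)) (vanish (suc L) (ℕ.n<1+n L)))
              (ℕ.+-identityʳ (Σbq L))

      no-small-fraction-at : ∀ {N j} s {m} → 1 ≤ N → suc N < j
        → DigitCondition j
        → ⟦ 0ℤ , m ⟧ j ℤ.< ⟦ sgn s * + Σbq N , 0ℤ ⟧ j
        → ⟦ sgn s * + Σbq N , - m ⟧ j ℤ.< ⟦ α ⟧ j
        → ⟦ sgn s * + Σbq N , - m ⟧ j ℤ.< ⟦ 1-α ⟧ j → ⊥
      no-small-fraction-at {N} {j} s {m} 1≤N N+1<j digits 0<y y<α y<1-α =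
        let K , x-between = ostrowski-middle 1≤N N+1<j digits
            0<r , r<P , r<Q-P = fraction-bounds {c = sgn s * + Σbq N} {m} {P j} {Q j} 0<y y<α y<1-α
        in no-residue-in-window s (K - + Σbp N + sgn s * m) 0<r r<P r<Q-P x-between
             (residue-congruence s {+ Σbq N} {P j} {Q j} {+ Σbp N} {m} {K})

      fractional-part-not-small : ∀ {n N} → 1 ≤ N → n ≡ Σbq N → 1 ≤ n
        → (2 ≤ b 0 ⊎ (((+ 0 , + 1) <[ a ] (+ 2 , + 0)) × 2 ≤ b 1))
        → ∀ s {m} → (+ 0 , m) ≤[ a ] (sgn s * + n , + 0)
        → (sgn s * + n , - m) <[ a ] α → (sgn s * + n , - m) <[ a ] 1-α → ⊥
      fractional-part-not-small _ _ 1≤n _ s (inj₂ 0≡σn) _ _ = sgn*pos≢0 s 1≤n (cong proj₁ 0≡σn)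
      fractional-part-not-small {N = N} 1≤N refl _ digits s {m} (inj₁ 0<y) y<α y<1-α =
        let j , N+1<j , digits-at-j , 0<yⱼ , yⱼ<α , yⱼ<1-α =
              eventually-witness
                (eventually-× (eventually-≥ (2 ℕ.+ N))
                (eventually-× (eventually-digit-condition digits)
                (eventually-× (<[]⇒eventually {0ℤ , m} {σn , 0ℤ} 0<y)
                (eventually-× (<[]⇒eventually {σn , - m} {α} y<α)
                              (<[]⇒eventually {σn , - m} {1-α} y<1-α)))))
        in no-small-fraction-at s {m} 1≤N N+1<j digits-at-j 0<yⱼ yⱼ<α yⱼ<1-α
        where
        σn : ℤ
        σn = sgn s * + Σbq N

lemma5p11 : (a : ℕ → ℕ) → PartialQuotients a → (n : ℕ) → 1 ≤ n → (side : Side)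
    → (x₀ x₋ x₊ : Form)
    → SideVal a side (+ n) x₀ → NormVal a (+ n) x₀
    → SideVal a side (+ n - + 1) x₋ → SideVal a side (+ n + + 1) x₊
    → (b : ℕ → ℕ) → IsOstrowski a n b
    → (2 ≤ b 0 ⊎ (((+ 0 , + 1) <[ a ] (+ 2 , + 0)) × 2 ≤ b 1))
    → (x₋ <[ a ] x₀) ⊎ (x₊ <[ a ] x₀)
lemma5p11 a a-pos n 1≤n side _ _ _
  (m , (0≤y , _) , refl) _ (m₋ , (_ , below) , refl) (m₊ , (_ , above) , refl)
  b (L , vanish , n≡Σ , b₀<a₁ , bₖ₊₁≤aₖ₊₂ , _) digits =
  [ id
  , (λ (y<α , y<1-α) → ⊥-elim (fractional-part-not-small {N = suc L} (s≤s z≤n) n≡Σbq 1≤n digits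
                                                            side {m} 0≤y y<α y<1-α))
  ]′ (neighbours-or-small a-pos side {+ n} {m} {m₋} {m₊} below above)
  where
  open Convergents a
  open Ostrowski a-pos b b₀<a₁ bₖ₊₁≤aₖ₊₂
  n≡Σbq : n ≡ Σbq (suc L)
  n≡Σbq = trans n≡Σ (sym (Σbq-vanishing vanish))
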